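{- Let $f_1$ and $f_2$ be two non-constant elements of $\mathrm{QSym}$. Then the $F$-support of $f_1f_2$ contains at least one composition $\gamma$ whose first part $\gamma_1$ is at least $2$. Likewise, the $F$-support of $f_1f_2$ contains at least one composition whose last part is at least $2$.
   Context: $\mathrm{QSym}\subseteq\mathbb{Z}[[x_1,x_2,\dots]]$ is the ring of quasisymmetric functions with integer coefficients. For a composition $\alpha=(\alpha_1,\dots,\alpha_k)$ of $n$, let $S(\alpha)=\{\alpha_1,\alpha_1+\alpha_2,\dots,\alpha_1+\dots+\alpha_{k-1}\}\subseteq[n-1]$; the monomial quasisymmetric function is $M_\alpha=M_{S(\alpha),n}=\sum_{i_1<\dots<i_k}x_{i_1}^{\alpha_1}\cdots x_{i_k}^{\alpha_k}$, and the fundamental quasisymmetric function is $F_\alpha=F_{S(\alpha),n}=\sum_{S(\alpha)\subseteq T\subseteq[n-1]}M_{T,n}$. The $F$'s form a basis of $\mathrm{QSym}$, and the $F$-support of $f\in\mathrm{QSym}$ is the set of compositions $\alpha$ whose coefficient of $F_\alpha$ in the $F$-expansion of $f$ is nonzero. -}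

module Defs where

open import Data.Nat using (ℕ; zero; suc; _+_; _∸_; _≤_; _<_; _≡ᵇ_)
open import Data.Nat.Properties using (_≟_)
open import Data.Bool using (Bool; true; false; if_then_else_)
open import Data.List using (List; []; _∷_; map; upTo; _++_; concatMap; foldr)
open import Data.Nat.ListAction using (sum)
open import Data.Bool.ListAction using (all; any)
open import Data.List.Properties using (≡-dec)
open import Data.List.Relation.Unary.All using (All)
open import Data.Product using (_×_; _,_; proj₁)
open import Data.Integer using (ℤ; 0ℤ; 1ℤ) renaming (_+_ to _+ℤ_; _*_ to _*ℤ_)
open import Data.Empty using (⊥)
open import Relation.Nullary.Decidable using (⌊_⌋)

-- Exponent vectors (monomials x_1^{e_1} x_2^{e_2} ...); trailing zeros irrelevant.
Monomial : Set
Monomial = List ℕ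

Series : Set
Series = Monomial → ℤ

sumℤ : List ℤ → ℤ
sumℤ = foldr _+ℤ_ 0ℤ

splits : Monomial → List (Monomial × Monomial)
splits [] = ([] , []) ∷ []
splits (k ∷ e) = concatMap (λ i → map (λ { (a , b) → (i ∷ a , (k ∸ i) ∷ b) }) (splits e)) (upTo (suc k))

_*ˢ_ : Series → Series → Series
(f *ˢ g) e = sumℤ (map (λ { (a , b) → f a *ℤ g b }) (splits e))

IsComposition : List ℕ → Set
IsComposition α = All (0 <_) α

nz : Monomial → List ℕ
nz [] = []
nz (zero ∷ e) = nz e
nz (suc k ∷ e) = suc k ∷ nz e

eqList : List ℕ → List ℕ → Bool
eqList a b = ⌊ ≡-dec _≟_ a b ⌋

-- M_α = Σ_{i_1<...<i_k} x_{i_1}^{α_1}...x_{i_k}^{α_k}: coefficient of x^e is 1 iff the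
-- nonzero exponents of e, read in order, are α.
Mser : List ℕ → Series
Mser α e = if eqList (nz e) α then 1ℤ else 0ℤ

psumsFrom : ℕ → List ℕ → List ℕ
psumsFrom acc [] = []
psumsFrom acc (a ∷ []) = []
psumsFrom acc (a ∷ b ∷ r) = (acc + a) ∷ psumsFrom (acc + a) (b ∷ r)

S : List ℕ → List ℕ
S α = psumsFrom 0 α

subsets : List ℕ → List (List ℕ)
subsets [] = [] ∷ []
subsets (x ∷ xs) = map (x ∷_) (subsets xs) ++ subsets xs

range : ℕ → List ℕ
range n = map suc (upTo (n ∸ 1))

-- composition of n corresponding to an increasing list T ⊆ [n-1]
diffs : ℕ → List ℕ → ℕ → List ℕ
diffs prev [] n = (n ∸ prev) ∷ []
diffs prev (t ∷ ts) n = (t ∸ prev) ∷ diffs t ts n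

compOf : List ℕ → ℕ → List ℕ
compOf T zero = []
compOf T (suc n) = diffs 0 T (suc n)

_⊆ᵇ_ : List ℕ → List ℕ → Bool
A ⊆ᵇ B = all (λ s → any (s ≡ᵇ_) B) A

Fser : List ℕ → Series
Fser α e = sumℤ (map (λ T → if S α ⊆ᵇ T then Mser (compOf T n) e else 0ℤ) (subsets (range n)))
  where n = sum α

-- An element of QSym given by its F-expansion: a finite list of (composition, coefficient)
FExp : Set
FExp = List (List ℕ × ℤ)

ValidExp : FExp → Set
ValidExp L = All (λ p → IsComposition (proj₁ p)) L

ser : FExp → Series
ser L e = sumℤ (map (λ { (α , c) → c *ℤ Fser α e }) L)

-- coefficient of F_γ in the expansion L (collecting repeated entries)
coeffF : FExp → List ℕ → ℤ
coeffF L γ = sumℤ (map (λ { (α , c) → if eqList α γ then c else 0ℤ }) L)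

IsConstant : Series → Set
IsConstant f = ∀ e → 0 < sum e → f e ≡ 0ℤ
  where open import Relation.Binary.PropositionalEquality using (_≡_)

FirstPartAtLeast2 : List ℕ → Set
FirstPartAtLeast2 [] = ⊥
FirstPartAtLeast2 (a ∷ _) = 2 ≤ a

LastPartAtLeast2 : List ℕ → Set
LastPartAtLeast2 [] = ⊥
LastPartAtLeast2 (a ∷ []) = 2 ≤ a
LastPartAtLeast2 (a ∷ b ∷ r) = LastPartAtLeast2 (b ∷ r)

-- Both factors are polynomials, so f₁f₂ is a quasisymmetric polynomial and has an F-expansion,
-- computed by Möbius inversion over the subsets of [n-1]. For the lexicographic order on
-- exponent vectors, the leading monomial of f₁f₂ is the product of the leading monomials of f₁
-- and f₂. A non-constant quasisymmetric fᵢ has a non-constant monomial, which by quasisymmetry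
-- can be moved to an exponent vector with positive first entry; hence the leading exponent of fᵢ
-- has positive first entry, and that of f₁f₂ has first entry at least 2. Every monomial of F_α
-- with α₁ = 1 has first nonzero exponent 1, so some F_γ with γ₁ ≥ 2 occurs in the expansion.
-- The reverse-lexicographic order gives the statement about last parts.

module Submission where

open import Defs
open import Level using (0ℓ)
import Algebra.Properties.CommutativeSemigroup as CommutativeSemigroupProperties
open import Data.Bool using (Bool; true; false; if_then_else_)
open import Data.Bool.Properties using (T-≡)
open import Data.Bool.ListAction using (any)
open import Data.List using (List; []; _∷_; [_]; map; _++_; concat; concatMap; applyUpTo; upTo; length; zipWith; reverse; filter; replicate)
import Data.List.Properties as List
open import Data.List.Relation.Unary.All as All using (All; []; _∷_)
import Data.List.Relation.Unary.All.Properties as All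
import Data.List.Relation.Unary.Any as Any
open import Data.List.Relation.Unary.Any using (here; there)
open import Data.List.Relation.Unary.Any.Properties using (any⁻)
open import Data.List.Membership.Propositional using (_∈_; lose)
open import Data.List.Membership.Propositional.Properties using (∈-concatMap⁺; ∈-map⁺; ∈-upTo⁺; ∈-filter⁺)
open import Data.List.Relation.Binary.Subset.Propositional using (_⊆_)
open import Data.List.Relation.Binary.Pointwise using (Pointwise)
open import Data.List.Relation.Binary.Lex.Core using (this; next)
open import Data.List.Relation.Binary.Lex.Strict using (Lex-≤; ≤-isTotalOrder)
open import Data.List.Relation.Binary.Permutation.Propositional.Properties using (↭-reverse)
open import Data.Nat using (ℕ; zero; suc; _+_; _∸_; _≤_; _<_; _≡ᵇ_; _≤?_; _<?_; s≤s; z≤n)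
open import Data.Nat.ListAction using (sum)
open import Data.Nat.ListAction.Properties using (sum-↭)
import Data.Nat.Properties as ℕP
open import Data.Integer using (ℤ; 0ℤ; 1ℤ; -_) renaming (_+_ to _+ℤ_; _*_ to _*ℤ_; _-_ to _-ℤ_)
import Data.Integer.Properties as ℤP
open import Data.Integer.Solver using (module +-*-Solver)
open import Data.Product using (∃; ∃₂; _×_; _,_; proj₁; proj₂)
open import Data.Sum using (_⊎_; inj₁; inj₂)
open import Data.Empty using (⊥; ⊥-elim)
open import Function.Base using (_on_)
open import Function.Bundles using (Equivalence)
open import Relation.Binary using (Rel; IsTotalOrder; TotalOrder)
open import Relation.Unary using (Decidable)
import Relation.Binary.Construct.On as On
open import Relation.Nullary using (¬_; Dec; yes; no; ¬?; _×-dec_)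
open import Relation.Binary.PropositionalEquality using (_≡_; _≢_; refl; sym; trans; cong; cong₂; subst)
open Relation.Binary.PropositionalEquality.≡-Reasoning

open CommutativeSemigroupProperties ℤP.+-commutativeSemigroup using () renaming (interchange to +ℤ-interchange)
open CommutativeSemigroupProperties ℕP.+-commutativeSemigroup using () renaming (interchange to +-interchange)


∑ : {A : Set} → (A → ℤ) → List A → ℤ
∑ f xs = sumℤ (map f xs)

syntax ∑ (λ x → e) xs = ∑[ x ∈ xs ] e

module _ {A : Set} where

  ∑-++ : (f : A → ℤ) (xs ys : List A) → ∑ f (xs ++ ys) ≡ ∑ f xs +ℤ ∑ f ys
  ∑-++ f [] ys = sym (ℤP.+-identityˡ _)
  ∑-++ f (x ∷ xs) ys = trans (cong (f x +ℤ_) (∑-++ f xs ys)) (sym (ℤP.+-assoc (f x) _ _))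

  ∑-cong : {f g : A → ℤ} (xs : List A) → (∀ x → f x ≡ g x) → ∑ f xs ≡ ∑ g xs
  ∑-cong [] f≗g = refl
  ∑-cong (x ∷ xs) f≗g = cong₂ _+ℤ_ (f≗g x) (∑-cong xs f≗g)

  ∑-cong-All : {f g : A → ℤ} {xs : List A} → All (λ x → f x ≡ g x) xs → ∑ f xs ≡ ∑ g xs
  ∑-cong-All [] = refl
  ∑-cong-All (p ∷ ps) = cong₂ _+ℤ_ p (∑-cong-All ps)

  ∑-zero : {f : A → ℤ} {xs : List A} → All (λ x → f x ≡ 0ℤ) xs → ∑ f xs ≡ 0ℤ
  ∑-zero [] = refl
  ∑-zero (p ∷ ps) rewrite p | ∑-zero ps = refl

  ∑-*ˡ : (c : ℤ) (f : A → ℤ) (xs : List A) → c *ℤ ∑ f xs ≡ ∑[ x ∈ xs ] (c *ℤ f x)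
  ∑-*ˡ c f [] = ℤP.*-zeroʳ c
  ∑-*ˡ c f (x ∷ xs) = trans (ℤP.*-distribˡ-+ c (f x) _) (cong (c *ℤ f x +ℤ_) (∑-*ˡ c f xs))

  ∑-*ʳ : (c : ℤ) (f : A → ℤ) (xs : List A) → ∑ f xs *ℤ c ≡ ∑[ x ∈ xs ] (f x *ℤ c)
  ∑-*ʳ c f [] = refl
  ∑-*ʳ c f (x ∷ xs) = trans (ℤP.*-distribʳ-+ c (f x) _) (cong (f x *ℤ c +ℤ_) (∑-*ʳ c f xs))

  ∑-+ : (f g : A → ℤ) (xs : List A) → ∑ f xs +ℤ ∑ g xs ≡ ∑[ x ∈ xs ] (f x +ℤ g x)
  ∑-+ f g [] = refl
  ∑-+ f g (x ∷ xs) = trans (+ℤ-interchange (f x) (∑ f xs) (g x) (∑ g xs)) (cong (f x +ℤ g x +ℤ_) (∑-+ f g xs))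

module _ {A B : Set} where

  ∑-map : (f : B → ℤ) (g : A → B) (xs : List A) → ∑ f (map g xs) ≡ ∑[ x ∈ xs ] f (g x)
  ∑-map f g [] = refl
  ∑-map f g (x ∷ xs) = cong (f (g x) +ℤ_) (∑-map f g xs)

  ∑-concatMap : (f : B → ℤ) (g : A → List B) (xs : List A) → ∑ f (concatMap g xs) ≡ ∑[ x ∈ xs ] ∑ f (g x)
  ∑-concatMap f g [] = refl
  ∑-concatMap f g (x ∷ xs) = trans (∑-++ f (g x) (concat (map g xs))) (cong (∑ f (g x) +ℤ_) (∑-concatMap f g xs))

  ∑-swap : (φ : A → B → ℤ) (xs : List A) (ys : List B) →
    ∑[ x ∈ xs ] ∑[ y ∈ ys ] φ x y ≡ ∑[ y ∈ ys ] ∑[ x ∈ xs ] φ x y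
  ∑-swap φ [] ys = sym (∑-zero (All.universal (λ _ → refl) ys))
  ∑-swap φ (x ∷ xs) ys = trans (cong (∑ (φ x) ys +ℤ_) (∑-swap φ xs ys)) (∑-+ (φ x) _ ys)

∑-applyUpTo-single : ∀ (F : ℕ → ℤ) g m j → j < m → (∀ i → i < m → i ≢ j → F (g i) ≡ 0ℤ) →
  ∑ F (applyUpTo g m) ≡ F (g j)
∑-applyUpTo-single F g (suc m) zero _ others =
  trans (cong (F (g 0) +ℤ_) (∑-zero (All.applyUpTo⁺₁ _ m (λ i<m → others _ (s≤s i<m) λ ()))))
        (ℤP.+-identityʳ _)
∑-applyUpTo-single F g (suc m) (suc j) (s≤s j<m) others =
  trans (cong₂ _+ℤ_ (others 0 (s≤s z≤n) λ ())
                    (∑-applyUpTo-single F (λ i → g (suc i)) m j j<m (λ i i<m i≢j → others (suc i) (s≤s i<m) (λ eq → i≢j (ℕP.suc-injective eq)))))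
        (ℤP.+-identityˡ _)

m-n+n≡m : ∀ m n → (m -ℤ n) +ℤ n ≡ m
m-n+n≡m m n = trans (ℤP.+-assoc m (- n) n) (trans (cong (m +ℤ_) (ℤP.+-inverseˡ n)) (ℤP.+-identityʳ m))

if-*ˡ : ∀ (b : Bool) c x → c *ℤ (if b then x else 0ℤ) ≡ (if b then c *ℤ x else 0ℤ)
if-*ˡ true c x = refl
if-*ˡ false c x = ℤP.*-zeroʳ c

if-*ʳ : ∀ (b : Bool) c x → (if b then c else 0ℤ) *ℤ x ≡ (if b then c *ℤ x else 0ℤ)
if-*ʳ true c x = refl
if-*ʳ false c x = refl

*-≢0 : ∀ i j → i *ℤ j ≢ 0ℤ → i ≢ 0ℤ × j ≢ 0ℤ
*-≢0 i j ij≢0 = (λ { refl → ij≢0 refl }) , (λ { refl → ij≢0 (ℤP.*-zeroʳ i) })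

indicator : Bool → ℤ
indicator b = if b then 1ℤ else 0ℤ

δ : ℕ → ℕ → ℤ
δ a b = indicator (a ≡ᵇ b)

entries≤sum : ∀ a → All (_≤ sum a) a
entries≤sum [] = []
entries≤sum (x ∷ a) = ℕP.m≤m+n x (sum a) ∷ All.map (λ y≤ → ℕP.≤-trans y≤ (ℕP.m≤n+m (sum a) x)) (entries≤sum a)

length≤sum : ∀ β → IsComposition β → length β ≤ sum β
length≤sum [] [] = z≤n
length≤sum (b ∷ β) (0<b ∷ β⁺) = ℕP.+-mono-≤ 0<b (length≤sum β β⁺)

head-sum-< : ∀ {x y X Y} → x < X → y ≤ Y → x + y ≢ X + Y
head-sum-< x<X y≤Y eq = ℕP.<-irrefl eq (ℕP.+-mono-<-≤ x<X y≤Y)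

zipWith-∷ʳ : ∀ a b x y → length a ≡ length b → zipWith _+_ (a ++ [ x ]) (b ++ [ y ]) ≡ zipWith _+_ a b ++ [ x + y ]
zipWith-∷ʳ [] [] x y _ = refl
zipWith-∷ʳ (u ∷ a) (v ∷ b) x y len = cong (u + v ∷_) (zipWith-∷ʳ a b x y (ℕP.suc-injective len))

length-reverse-≡ : ∀ (a b : List ℕ) → length a ≡ length b → length (reverse a) ≡ length (reverse b)
length-reverse-≡ a b len = trans (List.length-reverse a) (trans len (sym (List.length-reverse b)))

reverse-zipWith : ∀ a b → length a ≡ length b → reverse (zipWith _+_ a b) ≡ zipWith _+_ (reverse a) (reverse b)
reverse-zipWith [] [] _ = refl
reverse-zipWith (x ∷ a) (y ∷ b) len = begin
  reverse (x + y ∷ zipWith _+_ a b)                   ≡⟨ List.unfold-reverse (x + y) (zipWith _+_ a b) ⟩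
  reverse (zipWith _+_ a b) ++ [ x + y ]              ≡⟨ cong (_++ [ x + y ]) (reverse-zipWith a b len′) ⟩
  zipWith _+_ (reverse a) (reverse b) ++ [ x + y ]    ≡⟨ sym (zipWith-∷ʳ (reverse a) (reverse b) x y (length-reverse-≡ a b len′)) ⟩
  zipWith _+_ (reverse a ++ [ x ]) (reverse b ++ [ y ]) ≡⟨ sym (cong₂ (zipWith _+_) (List.unfold-reverse x a) (List.unfold-reverse y b)) ⟩
  zipWith _+_ (reverse (x ∷ a)) (reverse (y ∷ b))     ∎
  where len′ = ℕP.suc-injective len


eqList-refl : ∀ a → eqList a a ≡ true
eqList-refl a with List.≡-dec ℕP._≟_ a a
... | yes _ = refl
... | no a≢a = ⊥-elim (a≢a refl)

eqList-≢ : ∀ {a b} → a ≢ b → eqList a b ≡ false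
eqList-≢ {a} {b} a≢b with List.≡-dec ℕP._≟_ a b
... | yes a≡b = ⊥-elim (a≢b a≡b)
... | no _ = refl

eqList-sound : ∀ {a b} → eqList a b ≡ true → a ≡ b
eqList-sound {a} {b} eq with List.≡-dec ℕP._≟_ a b
eqList-sound {a} {b} refl | yes a≡b = a≡b

eqList-cong : ∀ {a b c d} → (a ≡ b → c ≡ d) → (c ≡ d → a ≡ b) → eqList a b ≡ eqList c d
eqList-cong {a} {b} {c} {d} to from with List.≡-dec ℕP._≟_ a b | List.≡-dec ℕP._≟_ c d
... | yes _ | yes _ = refl
... | no _ | no _ = refl
... | yes a≡b | no c≢d = ⊥-elim (c≢d (to a≡b))
... | no a≢b | yes c≡d = ⊥-elim (a≢b (from c≡d))

≡ᵇ-refl : ∀ x → (x ≡ᵇ x) ≡ true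
≡ᵇ-refl x = Equivalence.to T-≡ (ℕP.≡⇒≡ᵇ x x refl)

≢⇒≡ᵇ-false : ∀ {x y} → x ≢ y → (x ≡ᵇ y) ≡ false
≢⇒≡ᵇ-false {x} {y} x≢y with x ≡ᵇ y in eq
... | false = refl
... | true = ⊥-elim (x≢y (ℕP.≡ᵇ⇒≡ x y (Equivalence.from T-≡ eq)))

any-≡ᵇ-below : ∀ {x} V → All (x <_) V → any (x ≡ᵇ_) V ≡ false
any-≡ᵇ-below [] [] = refl
any-≡ᵇ-below (v ∷ vs) (x<v ∷ x<vs) rewrite ≢⇒≡ᵇ-false (ℕP.<⇒≢ x<v) = any-≡ᵇ-below vs x<vs

⊆ᵇ-cons-below : ∀ {x} A V → All (x <_) A → (A ⊆ᵇ (x ∷ V)) ≡ (A ⊆ᵇ V)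
⊆ᵇ-cons-below [] V [] = refl
⊆ᵇ-cons-below (a ∷ as) V (x<a ∷ x<as)
  rewrite ≢⇒≡ᵇ-false (ℕP.>⇒≢ x<a) | ⊆ᵇ-cons-below as V x<as = refl

⊆ᵇ⇒⊆ : ∀ A B → (A ⊆ᵇ B) ≡ true → A ⊆ B
⊆ᵇ⇒⊆ A B A⊆B {s} s∈A =
  Any.map (λ {b} → ℕP.≡ᵇ⇒≡ s b) (any⁻ (s ≡ᵇ_) B (All.lookup (All.all⁺ (λ a → any (a ≡ᵇ_) B) A (Equivalence.from T-≡ A⊆B)) s∈A))


nz-IsComposition : ∀ e → IsComposition (nz e)
nz-IsComposition [] = []
nz-IsComposition (zero ∷ e) = nz-IsComposition e
nz-IsComposition (suc k ∷ e) = ℕP.0<1+n ∷ nz-IsComposition e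

nz-composition : ∀ β → IsComposition β → nz β ≡ β
nz-composition [] [] = refl
nz-composition (suc b ∷ β) (_ ∷ β⁺) = cong (suc b ∷_) (nz-composition β β⁺)

nz-idem : ∀ e → nz (nz e) ≡ nz e
nz-idem e = nz-composition (nz e) (nz-IsComposition e)

sum-nz : ∀ e → sum (nz e) ≡ sum e
sum-nz [] = refl
sum-nz (zero ∷ e) = sum-nz e
sum-nz (suc k ∷ e) = cong (suc k +_) (sum-nz e)

sum-nz-≡ : ∀ {a b} → nz a ≡ nz b → sum a ≡ sum b
sum-nz-≡ {a} {b} eq = trans (sym (sum-nz a)) (trans (cong sum eq) (sum-nz b))

nz-∷-cong : ∀ i a b → nz a ≡ nz b → nz (i ∷ a) ≡ nz (i ∷ b)
nz-∷-cong zero a b eq = eq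
nz-∷-cong (suc i) a b eq = cong (suc i ∷_) eq

nz-++ : ∀ xs ys → nz (xs ++ ys) ≡ nz xs ++ nz ys
nz-++ [] ys = refl
nz-++ (zero ∷ xs) ys = nz-++ xs ys
nz-++ (suc x ∷ xs) ys = cong (suc x ∷_) (nz-++ xs ys)

nz-zeros : ∀ k → nz (replicate k 0) ≡ []
nz-zeros zero = refl
nz-zeros (suc k) = nz-zeros k

nz-reverse : ∀ e → nz (reverse e) ≡ reverse (nz e)
nz-reverse [] = refl
nz-reverse (x ∷ e) = begin
  nz (reverse (x ∷ e))          ≡⟨ cong nz (List.unfold-reverse x e) ⟩
  nz (reverse e ++ [ x ])       ≡⟨ nz-++ (reverse e) [ x ] ⟩
  nz (reverse e) ++ nz [ x ]    ≡⟨ cong (_++ nz [ x ]) (nz-reverse e) ⟩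
  reverse (nz e) ++ nz [ x ]    ≡⟨ last-entry x ⟩
  reverse (nz (x ∷ e))          ∎
  where
  last-entry : ∀ x → reverse (nz e) ++ nz [ x ] ≡ reverse (nz (x ∷ e))
  last-entry zero = List.++-identityʳ _
  last-entry (suc x) = sym (List.unfold-reverse (suc x) (nz e))


Ascending : ℕ → ℕ → List ℕ → Set
Ascending p n [] = p < n
Ascending p n (u ∷ us) = p < u × Ascending u n us

Ascending-bound : ∀ {p n} U → Ascending p n U → p < n
Ascending-bound [] p<n = p<n
Ascending-bound (u ∷ us) (p<u , asc) = ℕP.<-trans p<u (Ascending-bound us asc)

Ascending-below : ∀ {p n} U → Ascending p n U → All (p <_) U
Ascending-below [] _ = []
Ascending-below (u ∷ us) (p<u , asc) = p<u ∷ All.map (ℕP.<-trans p<u) (Ascending-below us asc)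

Ascending-weaken : ∀ {p q n} U → p ≤ q → Ascending q n U → Ascending p n U
Ascending-weaken [] p≤q q<n = ℕP.≤-<-trans p≤q q<n
Ascending-weaken (u ∷ us) p≤q (q<u , asc) = ℕP.≤-<-trans p≤q q<u , asc

subsets-Ascending : ∀ {p n} xs → Ascending p n xs → All (Ascending p n) (subsets xs)
subsets-Ascending [] p<n = p<n ∷ []
subsets-Ascending (x ∷ xs) (p<x , asc) =
  All.++⁺ (All.map⁺ (All.map (p<x ,_) ih)) (All.map (λ {U} → Ascending-weaken U (ℕP.<⇒≤ p<x)) ih)
  where ih = subsets-Ascending xs asc

interval : ℕ → ℕ → List ℕ
interval p zero = []
interval p (suc k) = p ∷ interval (suc p) k

Ascending-interval : ∀ q k → Ascending q (suc q + k) (interval (suc q) k)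
Ascending-interval q zero = ℕP.m≤m+n (suc q) 0
Ascending-interval q (suc k) = ℕP.n<1+n q , subst (λ N → Ascending (suc q) N (interval (suc (suc q)) k)) (sym (ℕP.+-suc (suc q) k)) (Ascending-interval (suc q) k)

map-suc-applyUpTo : ∀ p k (f : ℕ → ℕ) → (∀ i → f i ≡ p + i) → map suc (applyUpTo f k) ≡ interval (suc p) k
map-suc-applyUpTo p zero f f≗p+ = refl
map-suc-applyUpTo p (suc k) f f≗p+ =
  cong₂ _∷_ (cong suc (trans (f≗p+ 0) (ℕP.+-identityʳ p)))
    (map-suc-applyUpTo (suc p) k (λ i → f (suc i)) (λ i → trans (f≗p+ (suc i)) (ℕP.+-suc p i)))

range-interval : ∀ k → range (suc k) ≡ interval 1 k
range-interval k = map-suc-applyUpTo 0 k (λ i → i) (λ i → refl)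


Ascending-weakenʳ : ∀ {p n n′} U → n ≤ n′ → Ascending p n U → Ascending p n′ U
Ascending-weakenʳ [] n≤n′ p<n = ℕP.<-≤-trans p<n n≤n′
Ascending-weakenʳ (u ∷ us) n≤n′ (p<u , asc) = p<u , Ascending-weakenʳ us n≤n′ asc

range-suc-Ascending : ∀ k → Ascending 0 (suc k) (range (suc k))
range-suc-Ascending k = subst (Ascending 0 (suc k)) (sym (range-interval k)) (Ascending-interval 0 k)

range-Ascending : ∀ n → Ascending 0 (suc n) (range n)
range-Ascending zero = ℕP.0<1+n
range-Ascending (suc k) = Ascending-weakenʳ (range (suc k)) (ℕP.n≤1+n (suc k)) (range-suc-Ascending k)

-- Cuts n U: U is the set S(α) ⊆ [n-1] of a composition α of n, as a strictly increasing list.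
Cuts : ℕ → List ℕ → Set
Cuts zero U = U ≡ []
Cuts (suc k) U = Ascending 0 (suc k) U

subsets-range-Cuts : ∀ n → All (Cuts n) (subsets (range n))
subsets-range-Cuts zero = refl ∷ []
subsets-range-Cuts (suc k) = subsets-Ascending (range (suc k)) (range-suc-Ascending k)

diffs-IsComposition : ∀ {p n} U → Ascending p n U → IsComposition (diffs p U n)
diffs-IsComposition [] p<n = ℕP.m<n⇒0<n∸m p<n ∷ []
diffs-IsComposition (u ∷ us) (p<u , asc) = ℕP.m<n⇒0<n∸m p<u ∷ diffs-IsComposition us asc

∸-telescope : ∀ {p t n} → p ≤ t → t ≤ n → (t ∸ p) + (n ∸ t) ≡ n ∸ p
∸-telescope {p} {t} {n} p≤t t≤n = ℕP.+-cancelˡ-≡ p _ _ (begin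
  p + ((t ∸ p) + (n ∸ t)) ≡⟨ sym (ℕP.+-assoc p _ _) ⟩
  (p + (t ∸ p)) + (n ∸ t) ≡⟨ cong (_+ (n ∸ t)) (ℕP.m+[n∸m]≡n p≤t) ⟩
  t + (n ∸ t)             ≡⟨ ℕP.m+[n∸m]≡n t≤n ⟩
  n                       ≡⟨ sym (ℕP.m+[n∸m]≡n (ℕP.≤-trans p≤t t≤n)) ⟩
  p + (n ∸ p)             ∎)

sum-diffs : ∀ {p n} U → Ascending p n U → sum (diffs p U n) ≡ n ∸ p
sum-diffs {p} {n} [] _ = ℕP.+-identityʳ (n ∸ p)
sum-diffs {p} {n} (u ∷ us) (p<u , asc) =
  trans (cong ((u ∸ p) +_) (sum-diffs us asc)) (∸-telescope (ℕP.<⇒≤ p<u) (ℕP.<⇒≤ (Ascending-bound us asc)))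

psumsFrom-diffs : ∀ {p n} U → Ascending p n U → psumsFrom p (diffs p U n) ≡ U
psumsFrom-diffs [] _ = refl
psumsFrom-diffs {p} {n} (u ∷ us) (p<u , asc) =
  trans (unfold us) (cong₂ _∷_ p+[u∸p]≡u (trans (cong (λ q → psumsFrom q (diffs u us n)) p+[u∸p]≡u) (psumsFrom-diffs us asc)))
  where
  p+[u∸p]≡u = ℕP.m+[n∸m]≡n (ℕP.<⇒≤ p<u)
  unfold : ∀ vs → psumsFrom p (diffs p (u ∷ vs) n) ≡ (p + (u ∸ p)) ∷ psumsFrom (p + (u ∸ p)) (diffs u vs n)
  unfold [] = refl
  unfold (_ ∷ _) = refl

sum-compOf : ∀ n U → Cuts n U → sum (compOf U n) ≡ n
sum-compOf zero U _ = refl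
sum-compOf (suc k) U cuts = sum-diffs U cuts

S-compOf : ∀ n U → Cuts n U → S (compOf U n) ≡ U
S-compOf zero U U≡[] = sym U≡[]
S-compOf (suc k) U cuts = psumsFrom-diffs U cuts

compOf-IsComposition : ∀ n U → Cuts n U → IsComposition (compOf U n)
compOf-IsComposition zero U _ = []
compOf-IsComposition (suc k) U cuts = diffs-IsComposition U cuts

incHead : List ℕ → List ℕ
incHead [] = []
incHead (x ∷ xs) = suc x ∷ xs

diffs-suc : ∀ {q N} V → Ascending (suc q) N V → diffs q V N ≡ incHead (diffs (suc q) V N)
diffs-suc {q} {N} [] 1+q<N = cong (_∷ []) (ℕP.+-∸-assoc 1 {N} {suc q} (ℕP.<⇒≤ 1+q<N))
diffs-suc {q} {N} (u ∷ us) (1+q<u , _) = cong (_∷ diffs u us N) (ℕP.+-∸-assoc 1 {u} {suc q} (ℕP.<⇒≤ 1+q<u))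


-- Möbius inversion on subsets

zeta : List ℕ → (List ℕ → ℤ) → List ℕ → ℤ
zeta xs c V = ∑[ U ∈ subsets xs ] (if U ⊆ᵇ V then c U else 0ℤ)

-- Inverts zeta one ground element x at a time: a subset containing x gets the coefficients
-- of the difference g (x ∷ _) - g, one avoiding x those of g.
mobius : List ℕ → (List ℕ → ℤ) → List ℕ → ℤ
mobius [] g U = g U
mobius (x ∷ xs) g [] = mobius xs g []
mobius (x ∷ xs) g (u ∷ U) = if x ≡ᵇ u then mobius xs (λ V → g (x ∷ V) -ℤ g V) U else mobius xs g (u ∷ U)

mobius-below : ∀ x xs g U → All (x <_) U → mobius (x ∷ xs) g U ≡ mobius xs g U
mobius-below x xs g [] _ = refl
mobius-below x xs g (u ∷ U) (x<u ∷ _) rewrite ≢⇒≡ᵇ-false (ℕP.<⇒≢ x<u) = refl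

zeta-cons : ∀ x xs c V →
  zeta (x ∷ xs) c V ≡ ∑[ U ∈ subsets xs ] (if (x ∷ U) ⊆ᵇ V then c (x ∷ U) else 0ℤ) +ℤ ∑[ U ∈ subsets xs ] (if U ⊆ᵇ V then c U else 0ℤ)
zeta-cons x xs c V = trans (∑-++ F (map (x ∷_) (subsets xs)) (subsets xs)) (cong (_+ℤ ∑ F (subsets xs)) (∑-map F (x ∷_) (subsets xs)))
  where
  F : List ℕ → ℤ
  F U = if U ⊆ᵇ V then c U else 0ℤ

zeta-mobius : ∀ {p n} xs → Ascending p n xs → ∀ g → All (λ V → zeta xs (mobius xs g) V ≡ g V) (subsets xs)
zeta-mobius [] _ g = ℤP.+-identityʳ (g []) ∷ []
zeta-mobius (x ∷ xs) (_ , asc) g =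
  All.++⁺ (All.map⁺ (All.map with-x (All.zip (zeta-mobius xs asc g₁ , All.zip (zeta-mobius xs asc g , above-x)))))
          (All.map without-x (All.zip (zeta-mobius xs asc g , above-x)))
  where
  g₁ : List ℕ → ℤ
  g₁ V = g (x ∷ V) -ℤ g V
  above-x : All (All (x <_)) (subsets xs)
  above-x = All.map (λ {U} → Ascending-below U) (subsets-Ascending xs asc)
  with-x : ∀ {V} → zeta xs (mobius xs g₁) V ≡ g₁ V × zeta xs (mobius xs g) V ≡ g V × All (x <_) V →
           zeta (x ∷ xs) (mobius (x ∷ xs) g) (x ∷ V) ≡ g (x ∷ V)
  with-x {V} (ζ₁ , ζ , _) = begin
    zeta (x ∷ xs) (mobius (x ∷ xs) g) (x ∷ V)
      ≡⟨ trans (zeta-cons x xs (mobius (x ∷ xs) g) (x ∷ V))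
               (cong₂ _+ℤ_ (∑-cong-All (All.map (λ {U} → first U) above-x)) (∑-cong-All (All.map (λ {U} → second U) above-x))) ⟩
    zeta xs (mobius xs g₁) V +ℤ zeta xs (mobius xs g) V     ≡⟨ cong₂ _+ℤ_ ζ₁ ζ ⟩
    g₁ V +ℤ g V                                             ≡⟨ m-n+n≡m (g (x ∷ V)) (g V) ⟩
    g (x ∷ V)                                               ∎
    where
    first : ∀ U → All (x <_) U → (if (x ∷ U) ⊆ᵇ (x ∷ V) then mobius (x ∷ xs) g (x ∷ U) else 0ℤ) ≡ (if U ⊆ᵇ V then mobius xs g₁ U else 0ℤ)
    first U x<U rewrite ≡ᵇ-refl x | ⊆ᵇ-cons-below U V x<U = refl
    second : ∀ U → All (x <_) U → (if U ⊆ᵇ (x ∷ V) then mobius (x ∷ xs) g U else 0ℤ) ≡ (if U ⊆ᵇ V then mobius xs g U else 0ℤ)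
    second U x<U rewrite ⊆ᵇ-cons-below U V x<U | mobius-below x xs g U x<U = refl
  without-x : ∀ {V} → zeta xs (mobius xs g) V ≡ g V × All (x <_) V → zeta (x ∷ xs) (mobius (x ∷ xs) g) V ≡ g V
  without-x {V} (ζ , x<V) = begin
    zeta (x ∷ xs) (mobius (x ∷ xs) g) V
      ≡⟨ trans (zeta-cons x xs (mobius (x ∷ xs) g) V)
               (cong₂ _+ℤ_ (∑-zero (All.map (λ {U} _ → first U) above-x)) (∑-cong-All (All.map (λ {U} → second U) above-x))) ⟩
    0ℤ +ℤ zeta xs (mobius xs g) V                           ≡⟨ ℤP.+-identityˡ _ ⟩
    zeta xs (mobius xs g) V                                 ≡⟨ ζ ⟩
    g V                                                     ∎
    where
    first : ∀ U → (if (x ∷ U) ⊆ᵇ V then mobius (x ∷ xs) g (x ∷ U) else 0ℤ) ≡ 0ℤ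
    first U rewrite any-≡ᵇ-below V x<V = refl
    second : ∀ U → All (x <_) U → (if U ⊆ᵇ V then mobius (x ∷ xs) g U else 0ℤ) ≡ (if U ⊆ᵇ V then mobius xs g U else 0ℤ)
    second U x<U rewrite mobius-below x xs g U x<U = refl

eqList-incHead : ∀ a r d → eqList (suc a ∷ r) (incHead d) ≡ eqList (a ∷ r) d
eqList-incHead a r [] = trans (eqList-≢ {suc a ∷ r} {[]} λ ()) (sym (eqList-≢ {a ∷ r} {[]} λ ()))
eqList-incHead a r (x ∷ d) = eqList-cong (λ { refl → refl }) (λ { refl → refl })

eqList-one-incHead : ∀ r d → IsComposition d → eqList (1 ∷ r) (incHead d) ≡ false
eqList-one-incHead r [] _ = eqList-≢ {1 ∷ r} {[]} λ ()
eqList-one-incHead r (zero ∷ d) (() ∷ _)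
eqList-one-incHead r (suc x ∷ d) _ = eqList-≢ {1 ∷ r} {suc (suc x) ∷ d} λ ()

eqList-nil-incHead-diffs : ∀ p V n → eqList [] (incHead (diffs p V n)) ≡ false
eqList-nil-incHead-diffs p [] n = refl
eqList-nil-incHead-diffs p (_ ∷ _) n = refl

eqList-cons-one : ∀ r d → eqList (1 ∷ r) (1 ∷ d) ≡ eqList r d
eqList-cons-one r d = eqList-cong (λ { refl → refl }) (λ { refl → refl })

-- The cut sets of (q, N) ∩ ℕ are in bijection with the compositions of N ∸ q.
cuts-count : ∀ k q N → N ≡ suc q + k → ∀ β → IsComposition β →
  ∑[ V ∈ subsets (interval (suc q) k) ] indicator (eqList β (diffs q V N)) ≡ δ (sum β) (suc k)
cuts-count zero q N refl β β⁺ rewrite ℕP.+-identityʳ (suc q) | ℕP.m+n∸n≡m 1 q = trans (ℤP.+-identityʳ _) (single β β⁺)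
  where
  single : ∀ β → IsComposition β → indicator (eqList β (1 ∷ [])) ≡ δ (sum β) 1
  single [] _ = refl
  single (zero ∷ _) (() ∷ _)
  single (1 ∷ zero ∷ _) (_ ∷ () ∷ _)
  single (1 ∷ []) _ = refl
  single (1 ∷ suc b ∷ r) _ rewrite eqList-≢ {1 ∷ suc b ∷ r} {1 ∷ []} (λ ()) = refl
  single (suc (suc a) ∷ r) _ rewrite eqList-≢ {suc (suc a) ∷ r} {1 ∷ []} (λ ()) = refl
cuts-count (suc k) q N N≡ β β⁺ = begin
    ∑ count (map (suc q ∷_) S′ ++ S′)
      ≡⟨ ∑-++ count (map (suc q ∷_) S′) S′ ⟩
    ∑ count (map (suc q ∷_) S′) +ℤ ∑ count S′
      ≡⟨ cong₂ _+ℤ_ (trans (∑-map count (suc q ∷_) S′) (∑-cong S′ with-cut))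
                    (∑-cong-All (All.map (λ {V} asc → cong (λ d → indicator (eqList β d)) (diffs-suc V asc)) S′-Ascending)) ⟩
    ∑[ V ∈ S′ ] indicator (eqList β (1 ∷ diffs (suc q) V N)) +ℤ ∑[ V ∈ S′ ] indicator (eqList β (incHead (diffs (suc q) V N)))
      ≡⟨ by-first-part β β⁺ ⟩
    δ (sum β) (suc (suc k)) ∎
  where
  S′ : List (List ℕ)
  S′ = subsets (interval (suc (suc q)) k)
  count : List ℕ → ℤ
  count V = indicator (eqList β (diffs q V N))
  N≡′ : N ≡ suc (suc q) + k
  N≡′ = trans N≡ (ℕP.+-suc (suc q) k)
  S′-Ascending : All (Ascending (suc q) N) S′
  S′-Ascending = subsets-Ascending _ (subst (λ M → Ascending (suc q) M (interval (suc (suc q)) k)) (sym N≡′) (Ascending-interval (suc q) k))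
  with-cut : ∀ V → count (suc q ∷ V) ≡ indicator (eqList β (1 ∷ diffs (suc q) V N))
  with-cut V rewrite ℕP.m+n∸n≡m 1 q = refl
  by-first-part : ∀ β → IsComposition β →
    ∑[ V ∈ S′ ] indicator (eqList β (1 ∷ diffs (suc q) V N)) +ℤ ∑[ V ∈ S′ ] indicator (eqList β (incHead (diffs (suc q) V N)))
      ≡ δ (sum β) (suc (suc k))
  by-first-part [] _ =
    cong₂ _+ℤ_ (∑-zero (All.map (λ _ → refl) S′-Ascending))
               (∑-zero (All.map (λ {V} _ → cong indicator (eqList-nil-incHead-diffs (suc q) V N)) S′-Ascending))
  by-first-part (1 ∷ r) (_ ∷ r⁺) =
    trans (cong₂ _+ℤ_ (trans (∑-cong S′ (λ V → cong indicator (eqList-cons-one r (diffs (suc q) V N)))) (cuts-count k (suc q) N N≡′ r r⁺))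
                      (∑-zero (All.map (λ {V} asc → cong indicator (eqList-one-incHead r _ (diffs-IsComposition V asc))) S′-Ascending)))
          (ℤP.+-identityʳ _)
  by-first-part (suc (suc a) ∷ r) (_ ∷ r⁺) =
    trans (cong₂ _+ℤ_ (∑-zero (All.map (λ {V} _ → cong indicator (eqList-≢ {suc (suc a) ∷ r} {1 ∷ diffs (suc q) V N} (λ ()))) S′-Ascending))
                      (trans (∑-cong S′ (λ V → cong indicator (eqList-incHead (suc a) r (diffs (suc q) V N))))
                             (cuts-count k (suc q) N N≡′ (suc a ∷ r) (ℕP.0<1+n ∷ r⁺))))
          (ℤP.+-identityˡ _)

compositions-count : ∀ n β → IsComposition β → ∑[ V ∈ subsets (range n) ] indicator (eqList β (compOf V n)) ≡ δ (sum β) n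
compositions-count zero [] _ = refl
compositions-count zero (zero ∷ _) (() ∷ _)
compositions-count zero (suc b ∷ r) _ = refl
compositions-count (suc k) β β⁺ rewrite range-interval k = cuts-count k 0 (suc k) refl β β⁺


-- The F-expansion of a quasisymmetric polynomial

-- With exponent vectors as lists, quasisymmetry says that a coefficient only depends on the
-- sequence of nonzero exponents.
Quasisymmetric : Series → Set
Quasisymmetric f = ∀ a b → nz a ≡ nz b → f a ≡ f b

DegreeAtMost : ℕ → Series → Set
DegreeAtMost N f = ∀ e → N < sum e → f e ≡ 0ℤ

DegreeAtMost-mono : ∀ {D D′} (f : Series) → D ≤ D′ → DegreeAtMost D f → DegreeAtMost D′ f
DegreeAtMost-mono f D≤D′ f-deg e D′<e = f-deg e (ℕP.≤-<-trans D≤D′ D′<e)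

Fser-quasisymmetric : ∀ α → Quasisymmetric (Fser α)
Fser-quasisymmetric α a b nz-a≡nz-b = ∑-cong (subsets (range (sum α))) term
  where
  term : ∀ T → (if S α ⊆ᵇ T then Mser (compOf T (sum α)) a else 0ℤ) ≡ (if S α ⊆ᵇ T then Mser (compOf T (sum α)) b else 0ℤ)
  term T rewrite nz-a≡nz-b = refl

ser-quasisymmetric : ∀ L → Quasisymmetric (ser L)
ser-quasisymmetric L a b nz-a≡nz-b = ∑-cong L (λ { (α , c) → cong (c *ℤ_) (Fser-quasisymmetric α a b nz-a≡nz-b) })

Fser-unfold : ∀ α n U e → sum α ≡ n → S α ≡ U →
  Fser α e ≡ ∑[ V ∈ subsets (range n) ] (if U ⊆ᵇ V then Mser (compOf V n) e else 0ℤ)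
Fser-unfold α _ _ e refl refl = refl

Fser-vanishes : ∀ α e → (∀ T → Cuts (sum α) T → (S α ⊆ᵇ T) ≡ true → nz e ≢ compOf T (sum α)) → Fser α e ≡ 0ℤ
Fser-vanishes α e off-support = ∑-zero (All.map (λ {T} → term T) (subsets-range-Cuts (sum α)))
  where
  term : ∀ T → Cuts (sum α) T → (if S α ⊆ᵇ T then Mser (compOf T (sum α)) e else 0ℤ) ≡ 0ℤ
  term T cuts with S α ⊆ᵇ T in S⊆T
  ... | false = refl
  ... | true rewrite eqList-≢ (off-support T cuts S⊆T) = refl

Fser-degree : ∀ α → DegreeAtMost (sum α) (Fser α)
Fser-degree α e α<e = Fser-vanishes α e λ T cuts _ nz-e≡ → ℕP.<-irrefl (sym (begin
  sum e                       ≡⟨ sym (sum-nz e) ⟩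
  sum (nz e)                  ≡⟨ cong sum nz-e≡ ⟩
  sum (compOf T (sum α))      ≡⟨ sum-compOf (sum α) T cuts ⟩
  sum α                       ∎)) α<e

degreeBound : FExp → ℕ
degreeBound L = sum (map (λ p → sum (proj₁ p)) L)

ser-degree : ∀ L → DegreeAtMost (degreeBound L) (ser L)
ser-degree L e L<e = ∑-zero (All.map (λ {p} α≤L → trans (cong (proj₂ p *ℤ_) (Fser-degree (proj₁ p) e (ℕP.≤-<-trans α≤L L<e))) (ℤP.*-zeroʳ (proj₂ p)))
                                     (All.map⁻ (entries≤sum (map (λ p → sum (proj₁ p)) L))))

module F-Expansion (h : Series) (h-qsym : Quasisymmetric h) where

  coeff : ℕ → List ℕ → ℤ
  coeff n = mobius (range n) (λ V → h (compOf V n))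

  expansionOfDegree : ℕ → FExp
  expansionOfDegree n = map (λ U → (compOf U n , coeff n U)) (subsets (range n))

  expansionOfDegree-valid : ∀ n → ValidExp (expansionOfDegree n)
  expansionOfDegree-valid n = All.map⁺ (All.map (λ {U} → compOf-IsComposition n U) (subsets-range-Cuts n))

  ser-expansionOfDegree : ∀ e n → ser (expansionOfDegree n) e ≡ h e *ℤ δ (sum (nz e)) n
  ser-expansionOfDegree e n = begin
      ser (expansionOfDegree n) e
        ≡⟨ ∑-map (λ p → proj₂ p *ℤ Fser (proj₁ p) e) _ (subsets R) ⟩
      ∑[ U ∈ subsets R ] (coeff n U *ℤ Fser (compOf U n) e)
        ≡⟨ ∑-cong-All (All.map (λ {U} → expand-F U) (subsets-range-Cuts n)) ⟩
      ∑[ U ∈ subsets R ] ∑[ V ∈ subsets R ] (if U ⊆ᵇ V then coeff n U *ℤ m V else 0ℤ)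
        ≡⟨ ∑-swap (λ U V → if U ⊆ᵇ V then coeff n U *ℤ m V else 0ℤ) (subsets R) (subsets R) ⟩
      ∑[ V ∈ subsets R ] ∑[ U ∈ subsets R ] (if U ⊆ᵇ V then coeff n U *ℤ m V else 0ℤ)
        ≡⟨ ∑-cong (subsets R) factor-M ⟩
      ∑[ V ∈ subsets R ] (zeta R (coeff n) V *ℤ m V)
        ≡⟨ ∑-cong-All (All.map (cong (_*ℤ m _)) (zeta-mobius R (range-Ascending n) (λ V → h (compOf V n)))) ⟩
      ∑[ V ∈ subsets R ] (h (compOf V n) *ℤ m V)
        ≡⟨ ∑-cong-All (All.map (λ {V} → on-support V) (subsets-range-Cuts n)) ⟩
      ∑[ V ∈ subsets R ] (h e *ℤ m V)
        ≡⟨ sym (∑-*ˡ (h e) m (subsets R)) ⟩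
      h e *ℤ ∑ m (subsets R)
        ≡⟨ cong (h e *ℤ_) (compositions-count n (nz e) (nz-IsComposition e)) ⟩
      h e *ℤ δ (sum (nz e)) n ∎
    where
    R : List ℕ
    R = range n
    m : List ℕ → ℤ
    m V = Mser (compOf V n) e
    expand-F : ∀ U → Cuts n U → coeff n U *ℤ Fser (compOf U n) e ≡ ∑[ V ∈ subsets R ] (if U ⊆ᵇ V then coeff n U *ℤ m V else 0ℤ)
    expand-F U cuts = begin
      coeff n U *ℤ Fser (compOf U n) e
        ≡⟨ cong (coeff n U *ℤ_) (Fser-unfold (compOf U n) n U e (sum-compOf n U cuts) (S-compOf n U cuts)) ⟩
      coeff n U *ℤ ∑[ V ∈ subsets R ] (if U ⊆ᵇ V then m V else 0ℤ)
        ≡⟨ ∑-*ˡ (coeff n U) _ (subsets R) ⟩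
      ∑[ V ∈ subsets R ] (coeff n U *ℤ (if U ⊆ᵇ V then m V else 0ℤ))
        ≡⟨ ∑-cong (subsets R) (λ V → if-*ˡ (U ⊆ᵇ V) (coeff n U) (m V)) ⟩
      ∑[ V ∈ subsets R ] (if U ⊆ᵇ V then coeff n U *ℤ m V else 0ℤ) ∎
    factor-M : ∀ V → ∑[ U ∈ subsets R ] (if U ⊆ᵇ V then coeff n U *ℤ m V else 0ℤ) ≡ zeta R (coeff n) V *ℤ m V
    factor-M V = trans (∑-cong (subsets R) (λ U → sym (if-*ʳ (U ⊆ᵇ V) (coeff n U) (m V)))) (sym (∑-*ʳ (m V) _ (subsets R)))
    on-support : ∀ V → Cuts n V → h (compOf V n) *ℤ m V ≡ h e *ℤ m V
    on-support V cuts with eqList (nz e) (compOf V n) in nz-e≡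
    ... | false = trans (ℤP.*-zeroʳ (h (compOf V n))) (sym (ℤP.*-zeroʳ (h e)))
    ... | true = cong (_*ℤ 1ℤ) (h-qsym (compOf V n) e (trans (nz-composition _ (compOf-IsComposition n V cuts)) (sym (eqList-sound nz-e≡))))

  module _ (N : ℕ) (h-deg : DegreeAtMost N h) where

    expansion : FExp
    expansion = concatMap expansionOfDegree (upTo (suc N))

    expansion-valid : ValidExp expansion
    expansion-valid = All.concat⁺ (All.map⁺ {f = expansionOfDegree} (All.applyUpTo⁺₂ (λ n → n) (suc N) expansionOfDegree-valid))

    ser-expansion : ∀ e → ser expansion e ≡ h e
    ser-expansion e = begin
        ser expansion e
          ≡⟨ ∑-concatMap (λ p → proj₂ p *ℤ Fser (proj₁ p) e) expansionOfDegree (upTo (suc N)) ⟩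
        ∑[ n ∈ upTo (suc N) ] ser (expansionOfDegree n) e
          ≡⟨ ∑-cong (upTo (suc N)) (ser-expansionOfDegree e) ⟩
        ∑[ n ∈ upTo (suc N) ] (h e *ℤ δ s n)
          ≡⟨ by-degree (s ≤? N) ⟩
        h e ∎
      where
      s : ℕ
      s = sum (nz e)
      by-degree : Dec (s ≤ N) → ∑[ n ∈ upTo (suc N) ] (h e *ℤ δ s n) ≡ h e
      by-degree (yes s≤N) = begin
        ∑[ n ∈ upTo (suc N) ] (h e *ℤ δ s n)
          ≡⟨ ∑-applyUpTo-single (λ n → h e *ℤ δ s n) (λ n → n) (suc N) s (s≤s s≤N) off-diagonal ⟩
        h e *ℤ δ s s
          ≡⟨ cong (λ b → h e *ℤ indicator b) (≡ᵇ-refl s) ⟩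
        h e *ℤ 1ℤ
          ≡⟨ ℤP.*-identityʳ (h e) ⟩
        h e ∎
        where
        off-diagonal : ∀ n → n < suc N → n ≢ s → h e *ℤ δ s n ≡ 0ℤ
        off-diagonal n _ n≢s rewrite ≢⇒≡ᵇ-false (λ s≡n → n≢s (sym s≡n)) = ℤP.*-zeroʳ (h e)
      by-degree (no s≰N) = begin
        ∑[ n ∈ upTo (suc N) ] (h e *ℤ δ s n) ≡⟨ sym (∑-*ˡ (h e) (δ s) (upTo (suc N))) ⟩
        h e *ℤ ∑ (δ s) (upTo (suc N))        ≡⟨ cong (_*ℤ ∑ (δ s) (upTo (suc N))) h[e]≡0 ⟩
        0ℤ                                   ≡⟨ sym h[e]≡0 ⟩
        h e                                  ∎
        where
        h[e]≡0 : h e ≡ 0ℤ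
        h[e]≡0 = h-deg e (subst (N <_) (sum-nz e) (ℕP.≰⇒> s≰N))

F-expansion : (h : Series) (N : ℕ) → Quasisymmetric h → DegreeAtMost N h → ∃ λ L → ValidExp L × (∀ e → ser L e ≡ h e)
F-expansion h N h-qsym h-deg = expansion N h-deg , expansion-valid N h-deg , ser-expansion N h-deg
  where open F-Expansion h h-qsym


*ˢ-cons : ∀ (f g : Series) k e →
  (f *ˢ g) (k ∷ e) ≡ ∑[ i ∈ upTo (suc k) ] ((λ a → f (i ∷ a)) *ˢ (λ b → g ((k ∸ i) ∷ b))) e
*ˢ-cons f g k e =
  trans (∑-concatMap term (λ i → map (λ p → (i ∷ proj₁ p , (k ∸ i) ∷ proj₂ p)) (splits e)) (upTo (suc k)))
        (∑-cong (upTo (suc k)) (λ i → ∑-map term _ (splits e)))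
  where
  term : List ℕ × List ℕ → ℤ
  term p = f (proj₁ p) *ℤ g (proj₂ p)

*ˢ-cong : ∀ {f f′ g g′ : Series} e → (∀ a → f a ≡ f′ a) → (∀ b → g b ≡ g′ b) → (f *ˢ g) e ≡ (f′ *ˢ g′) e
*ˢ-cong e f≗f′ g≗g′ = ∑-cong (splits e) (λ p → cong₂ _*ℤ_ (f≗f′ (proj₁ p)) (g≗g′ (proj₂ p)))

-- A zero exponent only splits as 0 + 0, so it can be dropped from both factors.
*ˢ-nz : ∀ e (f g : Series) → Quasisymmetric f → Quasisymmetric g → (f *ˢ g) e ≡ (f *ˢ g) (nz e)
*ˢ-nz [] f g _ _ = refl
*ˢ-nz (zero ∷ e) f g f-qsym g-qsym = begin
  (f *ˢ g) (0 ∷ e)                              ≡⟨ trans (*ˢ-cons f g 0 e) (ℤP.+-identityʳ _) ⟩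
  (f₀ *ˢ g₀) e                                  ≡⟨ *ˢ-nz e f₀ g₀ (λ a b → f-qsym (0 ∷ a) (0 ∷ b)) (λ a b → g-qsym (0 ∷ a) (0 ∷ b)) ⟩
  (f₀ *ˢ g₀) (nz e)                             ≡⟨ *ˢ-cong (nz e) (λ a → f-qsym (0 ∷ a) a refl) (λ b → g-qsym (0 ∷ b) b refl) ⟩
  (f *ˢ g) (nz e)                               ∎
  where
  f₀ g₀ : Series
  f₀ a = f (0 ∷ a)
  g₀ b = g (0 ∷ b)
*ˢ-nz (suc k ∷ e) f g f-qsym g-qsym =
  trans (*ˢ-cons f g (suc k) e)
  (trans (∑-cong (upTo (suc (suc k)))
           (λ i → *ˢ-nz e (λ a → f (i ∷ a)) (λ b → g ((suc k ∸ i) ∷ b))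
                    (λ a b eq → f-qsym _ _ (nz-∷-cong i a b eq))
                    (λ a b eq → g-qsym _ _ (nz-∷-cong (suc k ∸ i) a b eq))))
         (sym (*ˢ-cons f g (suc k) (nz e))))

*ˢ-quasisymmetric : ∀ (f g : Series) → Quasisymmetric f → Quasisymmetric g → Quasisymmetric (f *ˢ g)
*ˢ-quasisymmetric f g f-qsym g-qsym a b nz-a≡nz-b =
  trans (*ˢ-nz a f g f-qsym g-qsym) (trans (cong (f *ˢ g) nz-a≡nz-b) (sym (*ˢ-nz b f g f-qsym g-qsym)))

data Split : List ℕ → List ℕ → List ℕ → Set where
  [] : Split [] [] []
  _∷_ : ∀ {i j k a b e} → i + j ≡ k → Split a b e → Split (i ∷ a) (j ∷ b) (k ∷ e)

splits-Split : ∀ e → All (λ p → Split (proj₁ p) (proj₂ p) e) (splits e)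
splits-Split [] = [] ∷ []
splits-Split (k ∷ e) =
  All.concat⁺ (All.map⁺ (All.applyUpTo⁺₁ (λ i → i) (suc k)
    (λ i<1+k → All.map⁺ (All.map (ℕP.m+[n∸m]≡n (ℕP.≤-pred i<1+k) ∷_) (splits-Split e)))))

Split-sum : ∀ {a b e} → Split a b e → sum a + sum b ≡ sum e
Split-sum [] = refl
Split-sum (_∷_ {i} {j} {a = a} {b} i+j≡k split) =
  trans (+-interchange i (sum a) j (sum b)) (cong₂ _+_ i+j≡k (Split-sum split))

Split-length : ∀ {a b e} → Split a b e → length a ≡ length e × length b ≡ length e
Split-length [] = refl , refl
Split-length (_ ∷ split) with Split-length split
... | la , lb = cong suc la , cong suc lb

Split-zipWith : ∀ A B → length A ≡ length B → Split A B (zipWith _+_ A B)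
Split-zipWith [] [] _ = []
Split-zipWith (x ∷ A) (y ∷ B) eq = refl ∷ Split-zipWith A B (ℕP.suc-injective eq)

Split⇒zipWith : ∀ {a b e} → Split a b e → zipWith _+_ a b ≡ e
Split⇒zipWith [] = refl
Split⇒zipWith (i+j≡k ∷ split) = cong₂ _∷_ i+j≡k (Split⇒zipWith split)

*ˢ-degree : ∀ (f g : Series) D₁ D₂ → DegreeAtMost D₁ f → DegreeAtMost D₂ g → DegreeAtMost (D₁ + D₂) (f *ˢ g)
*ˢ-degree f g D₁ D₂ f-deg g-deg e D<e = ∑-zero (All.map (λ {p} → term p) (splits-Split e))
  where
  term : ∀ p → Split (proj₁ p) (proj₂ p) e → f (proj₁ p) *ℤ g (proj₂ p) ≡ 0ℤ
  term (a , b) split with D₁ <? sum a | D₂ <? sum b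
  ... | yes D₁<a | _ rewrite f-deg a D₁<a = refl
  ... | no _ | yes D₂<b rewrite g-deg b D₂<b = ℤP.*-zeroʳ (f a)
  ... | no D₁≮a | no D₂≮b = ⊥-elim (ℕP.<-irrefl refl (ℕP.<-≤-trans D<e
          (subst (_≤ D₁ + D₂) (Split-sum split) (ℕP.+-mono-≤ (ℕP.≮⇒≥ D₁≮a) (ℕP.≮⇒≥ D₂≮b)))))

∑-splits-single : ∀ {A B e} → Split A B e → (φ : List ℕ × List ℕ → ℤ) →
  (∀ a b → Split a b e → (a ≡ A × b ≡ B) ⊎ φ (a , b) ≡ 0ℤ) → ∑ φ (splits e) ≡ φ (A , B)
∑-splits-single [] φ only-AB = ℤP.+-identityʳ _
∑-splits-single {i ∷ A} {j ∷ B} {k ∷ e} (i+j≡k ∷ split) φ only-AB = begin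
    ∑ φ (splits (k ∷ e))
      ≡⟨ ∑-concatMap φ (λ i′ → map (λ p → (i′ ∷ proj₁ p , (k ∸ i′) ∷ proj₂ p)) (splits e)) (upTo (suc k)) ⟩
    ∑[ i′ ∈ upTo (suc k) ] ∑ φ (map (λ p → (i′ ∷ proj₁ p , (k ∸ i′) ∷ proj₂ p)) (splits e))
      ≡⟨ ∑-cong (upTo (suc k)) (λ i′ → ∑-map φ _ (splits e)) ⟩
    ∑[ i′ ∈ upTo (suc k) ] ∑[ p ∈ splits e ] φ (i′ ∷ proj₁ p , (k ∸ i′) ∷ proj₂ p)
      ≡⟨ ∑-applyUpTo-single _ (λ i′ → i′) (suc k) i (s≤s (subst (i ≤_) i+j≡k (ℕP.m≤m+n i j))) other-first-parts ⟩
    ∑[ p ∈ splits e ] φ (i ∷ proj₁ p , (k ∸ i) ∷ proj₂ p)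
      ≡⟨ ∑-splits-single split (λ p → φ (i ∷ proj₁ p , (k ∸ i) ∷ proj₂ p)) only-AB-tail ⟩
    φ (i ∷ A , (k ∸ i) ∷ B)
      ≡⟨ cong (λ j′ → φ (i ∷ A , j′ ∷ B)) k∸i≡j ⟩
    φ (i ∷ A , j ∷ B) ∎
  where
  k∸i≡j : k ∸ i ≡ j
  k∸i≡j = trans (cong (_∸ i) (sym i+j≡k)) (ℕP.m+n∸m≡n i j)
  tail : List ℕ → List ℕ
  tail [] = []
  tail (_ ∷ xs) = xs
  other-first-parts : ∀ i′ → i′ < suc k → i′ ≢ i → ∑[ p ∈ splits e ] φ (i′ ∷ proj₁ p , (k ∸ i′) ∷ proj₂ p) ≡ 0ℤ
  other-first-parts i′ i′≤k i′≢i = ∑-zero (All.map (λ {p} → term p) (splits-Split e))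
    where
    term : ∀ p → Split (proj₁ p) (proj₂ p) e → φ (i′ ∷ proj₁ p , (k ∸ i′) ∷ proj₂ p) ≡ 0ℤ
    term (a , b) split′ with only-AB (i′ ∷ a) ((k ∸ i′) ∷ b) (ℕP.m+[n∸m]≡n (ℕP.≤-pred i′≤k) ∷ split′)
    ... | inj₁ (refl , _) = ⊥-elim (i′≢i refl)
    ... | inj₂ φ≡0 = φ≡0
  only-AB-tail : ∀ a b → Split a b e → (a ≡ A × b ≡ B) ⊎ φ (i ∷ a , (k ∸ i) ∷ b) ≡ 0ℤ
  only-AB-tail a b split′ rewrite k∸i≡j with only-AB (i ∷ a) (j ∷ b) (i+j≡k ∷ split′)
  ... | inj₁ (a≡A , b≡B) = inj₁ (cong tail a≡A , cong tail b≡B)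
  ... | inj₂ φ≡0 = inj₂ φ≡0


-- Leading monomials

vectors : ℕ → ℕ → List (List ℕ)
vectors zero D = [] ∷ []
vectors (suc m) D = concatMap (λ i → map (i ∷_) (vectors m D)) (upTo (suc D))

vectors-length : ∀ m D → All (λ v → length v ≡ m) (vectors m D)
vectors-length zero D = refl ∷ []
vectors-length (suc m) D =
  All.concat⁺ (All.map⁺ (All.applyUpTo⁺₂ (λ i → i) (suc D) (λ i → All.map⁺ (All.map (cong suc) (vectors-length m D)))))

∈-vectors : ∀ m D a → length a ≡ m → All (_≤ D) a → a ∈ vectors m D
∈-vectors zero D [] _ _ = Any.here refl
∈-vectors (suc m) D (x ∷ a) len (x≤D ∷ a≤D) =
  ∈-concatMap⁺ (λ i → map (i ∷_) (vectors m D)) (Any.map (λ { refl → ∈-map⁺ (x ∷_) (∈-vectors m D a (ℕP.suc-injective len) a≤D) }) (∈-upTo⁺ (s≤s x≤D)))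

support-degree : ∀ {D} (f : Series) → DegreeAtMost D f → ∀ a → f a ≢ 0ℤ → sum a ≤ D
support-degree {D} f f-deg a fa≢0 with sum a ≤? D
... | yes a≤D = a≤D
... | no a≰D = ⊥-elim (fa≢0 (f-deg a (ℕP.≰⇒> a≰D)))

_≤lex_ : List ℕ → List ℕ → Set
_≤lex_ = Lex-≤ _≡_ _<_

_≤revlex_ : List ℕ → List ℕ → Set
a ≤revlex b = reverse a ≤lex reverse b

lex-isTotalOrder : IsTotalOrder (Pointwise _≡_) _≤lex_
lex-isTotalOrder = ≤-isTotalOrder ℕP.<-isStrictTotalOrder

revlex-isTotalOrder : IsTotalOrder (Pointwise _≡_ on reverse) _≤revlex_
revlex-isTotalOrder = On.isTotalOrder reverse lex-isTotalOrder

≤lex-head : ∀ {y Y b B} → (y ∷ b) ≤lex (Y ∷ B) → y ≤ Y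
≤lex-head (this y<Y) = ℕP.<⇒≤ y<Y
≤lex-head (next refl _) = ℕP.≤-refl

-- The monomial-order property: it makes the leading monomial of a product the product of the
-- leading monomials.
≤lex-cancel : ∀ {a A b B} → length a ≡ length b → length A ≡ length B → a ≤lex A → b ≤lex B →
  zipWith _+_ a b ≡ zipWith _+_ A B → a ≡ A × b ≡ B
≤lex-cancel {[]} {[]} {[]} {[]} _ _ _ _ _ = refl , refl
≤lex-cancel {[]} {X ∷ A} {[]} {Y ∷ B} _ _ _ _ ()
≤lex-cancel {x ∷ a} {X ∷ A} {y ∷ b} {Y ∷ B} _ _ (this x<X) b≤B eq =
  ⊥-elim (head-sum-< x<X (≤lex-head b≤B) (List.∷-injectiveˡ eq))
≤lex-cancel {x ∷ a} {X ∷ A} {y ∷ b} {Y ∷ B} _ _ (next refl _) (this y<Y) eq =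
  ⊥-elim (ℕP.<-irrefl (ℕP.+-cancelˡ-≡ x y Y (List.∷-injectiveˡ eq)) y<Y)
≤lex-cancel {x ∷ a} {X ∷ A} {y ∷ b} {Y ∷ B} la lA (next refl a≤A) (next refl b≤B) eq
  with ≤lex-cancel (ℕP.suc-injective la) (ℕP.suc-injective lA) a≤A b≤B (List.∷-injectiveʳ eq)
... | refl , refl = refl , refl

≤revlex-cancel : ∀ {a A b B} → length a ≡ length b → length A ≡ length B → a ≤revlex A → b ≤revlex B →
  zipWith _+_ a b ≡ zipWith _+_ A B → a ≡ A × b ≡ B
≤revlex-cancel {a} {A} {b} {B} la lA a≤A b≤B eq
  with ≤lex-cancel {reverse a} {reverse A} {reverse b} {reverse B} (length-reverse-≡ a b la) (length-reverse-≡ A B lA) a≤A b≤B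
         (trans (sym (reverse-zipWith a b la)) (trans (cong reverse eq) (reverse-zipWith A B lA)))
... | ra≡rA , rb≡rB = List.reverse-injective ra≡rA , List.reverse-injective rb≡rB

module Leading {_≈_ _≼_ : Rel (List ℕ) 0ℓ} (≼-isTotalOrder : IsTotalOrder _≈_ _≼_)
  (≼-cancel : ∀ {a A b B} → length a ≡ length b → length A ≡ length B → a ≼ A → b ≼ B →
              zipWith _+_ a b ≡ zipWith _+_ A B → a ≡ A × b ≡ B) where

  ≼-totalOrder : TotalOrder 0ℓ 0ℓ 0ℓ
  ≼-totalOrder = record { isTotalOrder = ≼-isTotalOrder }

  open import Data.List.Extrema ≼-totalOrder using (max; ⊥≤max; xs≤max; argmax-all)

  leading : (f : Series) (D : ℕ) → DegreeAtMost D f → ∀ es → length es ≡ D → f es ≢ 0ℤ →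
    ∃ λ A → (length A ≡ D × f A ≢ 0ℤ) × es ≼ A × (∀ a → length a ≡ D → f a ≢ 0ℤ → a ≼ A)
  leading f D f-deg es len fes≢0 = A , A-props , ⊥≤max es support , maximal
    where
    nonzero? : Decidable (λ v → f v ≢ 0ℤ)
    nonzero? v = ¬? (f v ℤP.≟ 0ℤ)
    support : List (List ℕ)
    support = filter nonzero? (vectors D D)
    A : List ℕ
    A = max es support
    A-props : length A ≡ D × f A ≢ 0ℤ
    A-props = argmax-all (λ v → v) (len , fes≢0)
                (All.zip (All.filter⁺ nonzero? (vectors-length D D) , All.all-filter nonzero? (vectors D D)))
    maximal : ∀ a → length a ≡ D → f a ≢ 0ℤ → a ≼ A
    maximal a len-a fa≢0 = All.lookup (xs≤max es support)
      (∈-filter⁺ nonzero? (∈-vectors D D a len-a (All.map (λ x≤ → ℕP.≤-trans x≤ (support-degree f f-deg a fa≢0)) (entries≤sum a))) fa≢0)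

  *ˢ-leading : (f g : Series) (D : ℕ) → DegreeAtMost D f → DegreeAtMost D g →
    ∀ es₁ es₂ → length es₁ ≡ D → length es₂ ≡ D → f es₁ ≢ 0ℤ → g es₂ ≢ 0ℤ →
    ∃₂ λ A B → es₁ ≼ A × es₂ ≼ B × length A ≡ length B × (f *ˢ g) (zipWith _+_ A B) ≢ 0ℤ
  *ˢ-leading f g D f-deg g-deg es₁ es₂ len₁ len₂ f≢0 g≢0
    with leading f D f-deg es₁ len₁ f≢0 | leading g D g-deg es₂ len₂ g≢0
  ... | A , (lA , fA≢0) , es₁≼A , A-max | B , (lB , gB≢0) , es₂≼B , B-max =
    A , B , es₁≼A , es₂≼B , lA≡lB , λ fg≡0 → product≢0 (trans (sym coefficient) fg≡0)
    where
    lA≡lB : length A ≡ length B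
    lA≡lB = trans lA (sym lB)
    split-AB : Split A B (zipWith _+_ A B)
    split-AB = Split-zipWith A B lA≡lB
    only-AB : ∀ a b → Split a b (zipWith _+_ A B) → (a ≡ A × b ≡ B) ⊎ f a *ℤ g b ≡ 0ℤ
    only-AB a b split with f a ℤP.≟ 0ℤ | g b ℤP.≟ 0ℤ
    ... | yes fa≡0 | _ rewrite fa≡0 = inj₂ refl
    ... | no _ | yes gb≡0 rewrite gb≡0 = inj₂ (ℤP.*-zeroʳ (f a))
    ... | no fa≢0 | no gb≢0 =
      inj₁ (≼-cancel (trans la (sym lb)) lA≡lB (A-max a la fa≢0) (B-max b lb gb≢0)
              (trans (Split⇒zipWith split) (sym (Split⇒zipWith split-AB))))
      where
      len-AB : length (zipWith _+_ A B) ≡ D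
      len-AB = trans (sym (proj₁ (Split-length split-AB))) lA
      la : length a ≡ D
      la = trans (proj₁ (Split-length split)) len-AB
      lb : length b ≡ D
      lb = trans (proj₂ (Split-length split)) len-AB
    coefficient : (f *ˢ g) (zipWith _+_ A B) ≡ f A *ℤ g B
    coefficient = ∑-splits-single split-AB (λ p → f (proj₁ p) *ℤ g (proj₂ p)) only-AB
    product≢0 : f A *ℤ g B ≢ 0ℤ
    product≢0 fAgB≡0 with ℤP.i*j≡0⇒i≡0∨j≡0 (f A) fAgB≡0
    ... | inj₁ fA≡0 = fA≢0 fA≡0
    ... | inj₂ gB≡0 = gB≢0 gB≡0

padRight padLeft : ℕ → List ℕ → List ℕ
padRight D xs = xs ++ replicate (D ∸ length xs) 0
padLeft D xs = replicate (D ∸ length xs) 0 ++ xs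

length-padRight : ∀ D xs → length xs ≤ D → length (padRight D xs) ≡ D
length-padRight D xs xs≤D = trans (List.length-++ xs) (trans (cong (length xs +_) (List.length-replicate (D ∸ length xs))) (ℕP.m+[n∸m]≡n xs≤D))

length-padLeft : ∀ D xs → length xs ≤ D → length (padLeft D xs) ≡ D
length-padLeft D xs xs≤D = trans (List.length-++ (replicate (D ∸ length xs) 0)) (trans (cong (_+ length xs) (List.length-replicate (D ∸ length xs))) (ℕP.m∸n+n≡m xs≤D))

nz-padRight : ∀ D xs → nz (padRight D xs) ≡ nz xs
nz-padRight D xs = trans (nz-++ xs _) (trans (cong (nz xs ++_) (nz-zeros (D ∸ length xs))) (List.++-identityʳ (nz xs)))

nz-padLeft : ∀ D xs → nz (padLeft D xs) ≡ nz xs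
nz-padLeft D xs = trans (nz-++ (replicate (D ∸ length xs) 0) xs) (cong (_++ nz xs) (nz-zeros (D ∸ length xs)))

nonconstant-witness : (f : Series) (D : ℕ) → Quasisymmetric f → DegreeAtMost D f → ¬ IsConstant f → ∃ λ e → 0 < sum e × f e ≢ 0ℤ
nonconstant-witness f D f-qsym f-deg f-nc with Any.any? (λ v → (0 <? sum v) ×-dec ¬? (f v ℤP.≟ 0ℤ)) (vectors D D)
... | yes found = Any.satisfied found
... | no none = ⊥-elim (f-nc constant)
  where
  constant : IsConstant f
  constant e 0<e with f e ℤP.≟ 0ℤ
  ... | yes fe≡0 = fe≡0
  ... | no fe≢0 = ⊥-elim (none (lose v∈vectors (subst (0 <_) (sym sum-v≡sum-e) 0<e , λ fv≡0 → fe≢0 (trans (sym fv≡fe) fv≡0))))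
    where
    e≤D = support-degree f f-deg e fe≢0
    v = padRight D (nz e)
    nz-v≡nz-e : nz v ≡ nz e
    nz-v≡nz-e = trans (nz-padRight D (nz e)) (nz-idem e)
    fv≡fe : f v ≡ f e
    fv≡fe = f-qsym v e nz-v≡nz-e
    sum-v≡sum-e : sum v ≡ sum e
    sum-v≡sum-e = sum-nz-≡ {v} {e} nz-v≡nz-e
    v∈vectors : v ∈ vectors D D
    v∈vectors = ∈-vectors D D v (length-padRight D (nz e) (ℕP.≤-trans (length≤sum (nz e) (nz-IsComposition e)) (subst (_≤ D) (sym (sum-nz e)) e≤D)))
                  (All.map (λ x≤ → ℕP.≤-trans x≤ (subst (_≤ D) (sym sum-v≡sum-e) e≤D)) (entries≤sum v))

HeadPositive : List ℕ → Set
HeadPositive [] = ⊥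
HeadPositive (x ∷ _) = 0 < x

≤lex-HeadPositive : ∀ {a b} → a ≤lex b → HeadPositive a → HeadPositive b
≤lex-HeadPositive (this x<y) 0<x = ℕP.<-trans 0<x x<y
≤lex-HeadPositive (next refl _) 0<x = 0<x

HeadPositive-++ : ∀ xs ys → HeadPositive xs → HeadPositive (xs ++ ys)
HeadPositive-++ (x ∷ xs) ys 0<x = 0<x

nz-HeadPositive : ∀ e → 0 < sum e → HeadPositive (nz e)
nz-HeadPositive (zero ∷ e) 0<e = nz-HeadPositive e 0<e
nz-HeadPositive (suc k ∷ e) _ = ℕP.0<1+n

zipWith-FirstPartAtLeast2 : ∀ A B → HeadPositive A → HeadPositive B → FirstPartAtLeast2 (nz (zipWith _+_ A B))
zipWith-FirstPartAtLeast2 (suc a ∷ A) (suc b ∷ B) _ _ = s≤s (ℕP.≤-trans (s≤s z≤n) (ℕP.m≤n+m (suc b) a))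

LastPartAtLeast2-∷ʳ : ∀ ys c → 2 ≤ c → LastPartAtLeast2 (ys ++ [ c ])
LastPartAtLeast2-∷ʳ [] c 2≤c = 2≤c
LastPartAtLeast2-∷ʳ (y ∷ []) c 2≤c = 2≤c
LastPartAtLeast2-∷ʳ (y ∷ y′ ∷ ys) c 2≤c = LastPartAtLeast2-∷ʳ (y′ ∷ ys) c 2≤c

FirstPartAtLeast2-reverse : ∀ xs → FirstPartAtLeast2 (reverse xs) → LastPartAtLeast2 xs
FirstPartAtLeast2-reverse xs first with reverse xs in rev-xs
... | c ∷ zs = subst LastPartAtLeast2 xs≡ (LastPartAtLeast2-∷ʳ (reverse zs) c first)
  where
  xs≡ : reverse zs ++ [ c ] ≡ xs
  xs≡ = trans (sym (List.unfold-reverse c zs)) (trans (cong reverse (sym rev-xs)) (List.reverse-involutive xs))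

padded-witness : (D : ℕ) (h : Series) → Quasisymmetric h → DegreeAtMost D h → ¬ IsConstant h → (pad : ℕ → List ℕ → List ℕ) →
  (∀ xs → length xs ≤ D → length (pad D xs) ≡ D) → (∀ xs → nz (pad D xs) ≡ nz xs) →
  ∃ λ e → 0 < sum e × length (pad D (nz e)) ≡ D × h (pad D (nz e)) ≢ 0ℤ
padded-witness D h h-qsym h-deg h-nc pad length-pad nz-pad with nonconstant-witness h D h-qsym h-deg h-nc
... | e , 0<e , he≢0 =
  e , 0<e , length-pad (nz e) (ℕP.≤-trans (length≤sum (nz e) (nz-IsComposition e)) (subst (_≤ D) (sym (sum-nz e)) (support-degree h h-deg e he≢0))) ,
  λ h≡0 → he≢0 (trans (sym (h-qsym _ e (trans (nz-pad (nz e)) (nz-idem e)))) h≡0)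

module _ (f g : Series) (D : ℕ) (f-qsym : Quasisymmetric f) (g-qsym : Quasisymmetric g)
         (f-deg : DegreeAtMost D f) (g-deg : DegreeAtMost D g) where

  first-part-witness : ¬ IsConstant f → ¬ IsConstant g → ∃ λ E → FirstPartAtLeast2 (nz E) × (f *ˢ g) E ≢ 0ℤ
  first-part-witness f-nc g-nc =
    let e₁ , 0<e₁ , len₁ , f≢0 = padded-witness D f f-qsym f-deg f-nc padRight (length-padRight D) (nz-padRight D)
        e₂ , 0<e₂ , len₂ , g≢0 = padded-witness D g g-qsym g-deg g-nc padRight (length-padRight D) (nz-padRight D)
        A , B , es₁≤A , es₂≤B , _ , fg≢0 =
          Leading.*ˢ-leading lex-isTotalOrder ≤lex-cancel f g D f-deg g-deg (padRight D (nz e₁)) (padRight D (nz e₂)) len₁ len₂ f≢0 g≢0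
    in zipWith _+_ A B ,
       zipWith-FirstPartAtLeast2 A B (≤lex-HeadPositive es₁≤A (padded-HeadPositive e₁ 0<e₁)) (≤lex-HeadPositive es₂≤B (padded-HeadPositive e₂ 0<e₂)) ,
       fg≢0
    where
    padded-HeadPositive : ∀ e → 0 < sum e → HeadPositive (padRight D (nz e))
    padded-HeadPositive e 0<e = HeadPositive-++ (nz e) _ (nz-HeadPositive e 0<e)

  -- Reversal turns last parts into first parts and the reverse-lexicographic order into the
  -- lexicographic one; padding on the left keeps the last nonzero exponent last.
  last-part-witness : ¬ IsConstant f → ¬ IsConstant g → ∃ λ E → LastPartAtLeast2 (nz E) × (f *ˢ g) E ≢ 0ℤ
  last-part-witness f-nc g-nc =
    let e₁ , 0<e₁ , len₁ , f≢0 = padded-witness D f f-qsym f-deg f-nc padLeft (length-padLeft D) (nz-padLeft D)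
        e₂ , 0<e₂ , len₂ , g≢0 = padded-witness D g g-qsym g-deg g-nc padLeft (length-padLeft D) (nz-padLeft D)
        A , B , es₁≤A , es₂≤B , lA≡lB , fg≢0 =
          Leading.*ˢ-leading revlex-isTotalOrder ≤revlex-cancel f g D f-deg g-deg (padLeft D (nz e₁)) (padLeft D (nz e₂)) len₁ len₂ f≢0 g≢0
    in zipWith _+_ A B ,
       FirstPartAtLeast2-reverse (nz (zipWith _+_ A B))
         (subst FirstPartAtLeast2 (trans (cong nz (sym (reverse-zipWith A B lA≡lB))) (nz-reverse (zipWith _+_ A B)))
           (zipWith-FirstPartAtLeast2 (reverse A) (reverse B)
             (≤lex-HeadPositive es₁≤A (padded-HeadPositive e₁ 0<e₁)) (≤lex-HeadPositive es₂≤B (padded-HeadPositive e₂ 0<e₂)))) ,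
       fg≢0
    where
    padded-HeadPositive : ∀ e → 0 < sum e → HeadPositive (reverse (padLeft D (nz e)))
    padded-HeadPositive e 0<e =
      subst HeadPositive (sym (List.reverse-++ (replicate (D ∸ length (nz e)) 0) (nz e)))
        (HeadPositive-++ (reverse (nz e)) _
          (subst HeadPositive (nz-reverse e) (nz-HeadPositive (reverse e) (subst (0 <_) (sym (sum-↭ (↭-reverse e))) 0<e))))


dropKey : List ℕ → FExp → FExp
dropKey α [] = []
dropKey α (p ∷ L) = if eqList (proj₁ p) α then dropKey α L else p ∷ dropKey α L

dropKey-length : ∀ α L → length (dropKey α L) ≤ length L
dropKey-length α [] = z≤n
dropKey-length α (p ∷ L) with eqList (proj₁ p) α
... | true = ℕP.m≤n⇒m≤1+n (dropKey-length α L)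
... | false = s≤s (dropKey-length α L)

dropKey-All : ∀ {P : List ℕ → Set} α L → All (λ p → P (proj₁ p)) L → All (λ p → P (proj₁ p) × proj₁ p ≢ α) (dropKey α L)
dropKey-All α [] [] = []
dropKey-All α (p ∷ L) (Pp ∷ PL) with eqList (proj₁ p) α in p≟α
... | true = dropKey-All α L PL
... | false = (Pp , λ { refl → true≢false (trans (sym (eqList-refl α)) p≟α) }) ∷ dropKey-All α L PL
  where
  true≢false : true ≢ false
  true≢false ()

coeffF-dropKey : ∀ α β L → β ≢ α → coeffF (dropKey α L) β ≡ coeffF L β
coeffF-dropKey α β [] _ = refl
coeffF-dropKey α β (p ∷ L) β≢α with eqList (proj₁ p) α in p≟α
... | true rewrite eqList-sound p≟α | eqList-≢ (λ α≡β → β≢α (sym α≡β)) = trans (coeffF-dropKey α β L β≢α) (sym (ℤP.+-identityˡ _))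
... | false = cong ((if eqList (proj₁ p) β then proj₂ p else 0ℤ) +ℤ_) (coeffF-dropKey α β L β≢α)

module CollectTerms (w : List ℕ → ℤ) where

  term : List ℕ × ℤ → ℤ
  term p = proj₂ p *ℤ w (proj₁ p)

  open +-*-Solver

  ∑-dropKey : ∀ α L → ∑ term L ≡ coeffF L α *ℤ w α +ℤ ∑ term (dropKey α L)
  ∑-dropKey α [] = refl
  ∑-dropKey α ((β , c) ∷ L) with eqList β α in β≟α
  ... | true rewrite eqList-sound β≟α =
    trans (cong (c *ℤ w α +ℤ_) (∑-dropKey α L))
          (solve 4 (λ c x C R → c :* x :+ (C :* x :+ R) := (c :+ C) :* x :+ R) refl c (w α) (coeffF L α) (∑ term (dropKey α L)))
  ... | false =
    trans (cong (c *ℤ w β +ℤ_) (∑-dropKey α L))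
          (solve 4 (λ t x C R → t :+ (C :* x :+ R) := (con 0ℤ :+ C) :* x :+ (t :+ R)) refl (c *ℤ w β) (w α) (coeffF L α) (∑ term (dropKey α L)))

  ∑-dropKey-head : ∀ α c L → coeffF ((α , c) ∷ L) α *ℤ w α ≡ 0ℤ → ∑ term ((α , c) ∷ L) ≡ ∑ term (dropKey α L)
  ∑-dropKey-head α c L Cw≡0 = begin
    ∑ term ((α , c) ∷ L)                                                ≡⟨ ∑-dropKey α ((α , c) ∷ L) ⟩
    coeffF ((α , c) ∷ L) α *ℤ w α +ℤ ∑ term (dropKey α ((α , c) ∷ L))  ≡⟨ cong₂ _+ℤ_ Cw≡0 (cong (∑ term) drop-head) ⟩
    0ℤ +ℤ ∑ term (dropKey α L)                                          ≡⟨ ℤP.+-identityˡ _ ⟩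
    ∑ term (dropKey α L)                                                ∎
    where
    drop-head : dropKey α ((α , c) ∷ L) ≡ dropKey α L
    drop-head rewrite eqList-refl α = refl

  nonzero-coefficient : ∀ {P : List ℕ → Set} n L → length L ≤ n → All (λ p → P (proj₁ p)) L → ∑ term L ≢ 0ℤ →
    ∃ λ γ → P γ × w γ ≢ 0ℤ × coeffF L γ ≢ 0ℤ
  nonzero-coefficient n [] _ [] ∑≢0 = ⊥-elim (∑≢0 refl)
  nonzero-coefficient (suc n) ((α , c) ∷ L) (s≤s L≤n) (Pα ∷ PL) ∑≢0 with coeffF ((α , c) ∷ L) α *ℤ w α ℤP.≟ 0ℤ
  ... | no Cw≢0 = α , Pα , proj₂ (*-≢0 (coeffF ((α , c) ∷ L) α) (w α) Cw≢0) , proj₁ (*-≢0 (coeffF ((α , c) ∷ L) α) (w α) Cw≢0)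
  ... | yes Cw≡0
    with nonzero-coefficient n (dropKey α L) (ℕP.≤-trans (dropKey-length α L) L≤n) (dropKey-All α L PL)
           (λ rest≡0 → ∑≢0 (trans (∑-dropKey-head α c L Cw≡0) rest≡0))
  ...   | γ , (Pγ , γ≢α) , wγ≢0 , Cγ≢0 = γ , Pγ , wγ≢0 , λ Cγ≡0 → Cγ≢0 (trans (coeffF-dropKey α γ L γ≢α) (coeffF-tail Cγ≡0))
    where
    coeffF-tail : coeffF ((α , c) ∷ L) γ ≡ 0ℤ → coeffF L γ ≡ 0ℤ
    coeffF-tail rewrite eqList-≢ (λ α≡γ → γ≢α (sym α≡γ)) = λ eq → trans (sym (ℤP.+-identityˡ _)) eq

FirstPartAtLeast2? : ∀ γ → Dec (FirstPartAtLeast2 γ)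
FirstPartAtLeast2? [] = no λ ()
FirstPartAtLeast2? (x ∷ _) = 2 ≤? x

LastPartAtLeast2? : ∀ γ → Dec (LastPartAtLeast2 γ)
LastPartAtLeast2? [] = no λ ()
LastPartAtLeast2? (x ∷ []) = 2 ≤? x
LastPartAtLeast2? (x ∷ y ∷ r) = LastPartAtLeast2? (y ∷ r)

F-support : (P : List ℕ → Set) → (∀ γ → Dec (P γ)) → ∀ L E → ValidExp L →
  (∀ α → IsComposition α → ¬ P α → Fser α E ≡ 0ℤ) → ser L E ≢ 0ℤ →
  ∃ λ γ → IsComposition γ × P γ × coeffF L γ ≢ 0ℤ
F-support P P? L E valid vanishing ser≢0
  with CollectTerms.nonzero-coefficient (λ α → Fser α E) (length L) L ℕP.≤-refl valid ser≢0
... | γ , γ-composition , Fγ≢0 , coeff≢0 with P? γ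
...   | yes Pγ = γ , γ-composition , Pγ , coeff≢0
...   | no ¬Pγ = ⊥-elim (Fγ≢0 (vanishing γ γ-composition ¬Pγ))

Fser-[]-vanishes : ∀ e → nz e ≢ [] → Fser [] e ≡ 0ℤ
Fser-[]-vanishes e nz-e≢[] = Fser-vanishes [] e λ { T refl _ → nz-e≢[] }

Fser-[1]-vanishes : ∀ e → nz e ≢ 1 ∷ [] → Fser (1 ∷ []) e ≡ 0ℤ
Fser-[1]-vanishes e nz-e≢[1] = Fser-vanishes (1 ∷ []) e λ
  { [] _ _ → nz-e≢[1]
  ; (u ∷ us) (0<u , asc) _ _ → ℕP.<-irrefl refl (ℕP.<-≤-trans 0<u (ℕP.≤-pred (Ascending-bound us asc))) }

diffs-first-part-1 : ∀ {n} T → Ascending 0 n T → 1 ∈ T → ¬ FirstPartAtLeast2 (diffs 0 T n)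
diffs-first-part-1 (.1 ∷ us) _ (here refl) (s≤s ())
diffs-first-part-1 (u ∷ us) (0<u , asc) (there 1∈us) _ =
  ℕP.<-irrefl refl (ℕP.<-≤-trans 0<u (ℕP.≤-pred (All.lookup (Ascending-below us asc) 1∈us)))

Fser-first-part-vanishes : ∀ α e → IsComposition α → ¬ FirstPartAtLeast2 α → FirstPartAtLeast2 (nz e) → Fser α e ≡ 0ℤ
Fser-first-part-vanishes [] e _ _ first = Fser-[]-vanishes e λ nz-e≡[] → subst FirstPartAtLeast2 nz-e≡[] first
Fser-first-part-vanishes (zero ∷ _) e (() ∷ _)
Fser-first-part-vanishes (suc (suc a) ∷ _) e _ not-first _ = ⊥-elim (not-first (s≤s (s≤s z≤n)))
Fser-first-part-vanishes (1 ∷ []) e _ _ first = Fser-[1]-vanishes e λ nz-e≡[1] → ℕP.<-irrefl refl (subst FirstPartAtLeast2 nz-e≡[1] first)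
Fser-first-part-vanishes (1 ∷ b ∷ r) e _ _ first = Fser-vanishes (1 ∷ b ∷ r) e λ T cuts S⊆T nz-e≡ →
  diffs-first-part-1 T cuts (⊆ᵇ⇒⊆ (S (1 ∷ b ∷ r)) T S⊆T (here refl)) (subst FirstPartAtLeast2 nz-e≡ first)

psumsFrom-last-cut : ∀ acc a b r → IsComposition (b ∷ r) → ¬ LastPartAtLeast2 (b ∷ r) →
  (acc + (a + sum (b ∷ r))) ∸ 1 ∈ psumsFrom acc (a ∷ b ∷ r)
psumsFrom-last-cut acc a zero [] (() ∷ _) _
psumsFrom-last-cut acc a (suc (suc b)) [] _ not-last = ⊥-elim (not-last (s≤s (s≤s z≤n)))
psumsFrom-last-cut acc a 1 [] _ _ = here (trans (cong (_∸ 1) (sym (ℕP.+-assoc acc a 1))) (ℕP.m+n∸n≡m (acc + a) 1))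
psumsFrom-last-cut acc a b (c ∷ r) (_ ∷ cr⁺) not-last =
  there (subst (λ s → s ∸ 1 ∈ psumsFrom (acc + a) (b ∷ c ∷ r)) (ℕP.+-assoc acc a _) (psumsFrom-last-cut (acc + a) b c r cr⁺ not-last))

diffs-last-part-1 : ∀ {p n} T → Ascending p n T → (n ∸ 1) ∈ T → ¬ LastPartAtLeast2 (diffs p T n)
diffs-last-part-1 {n = n} (u ∷ []) (_ , u<n) (here refl) last =
  ℕP.<-irrefl refl (subst (2 ≤_) (ℕP.m∸[m∸n]≡n {n} {1} (ℕP.≤-trans (s≤s z≤n) u<n)) last)
diffs-last-part-1 {n = zero} (u ∷ v ∷ vs) (_ , _ , asc) (here _) _ = ℕP.n≮0 (Ascending-bound vs asc)
diffs-last-part-1 {n = suc k} (.k ∷ v ∷ vs) (_ , k<v , asc) (here refl) _ =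
  ℕP.<-irrefl refl (ℕP.<-≤-trans k<v (ℕP.≤-pred (Ascending-bound vs asc)))
diffs-last-part-1 (u ∷ v ∷ vs) (_ , asc) (there n-1∈) last = diffs-last-part-1 (v ∷ vs) asc n-1∈ last

Fser-last-part-vanishes : ∀ α e → IsComposition α → ¬ LastPartAtLeast2 α → LastPartAtLeast2 (nz e) → Fser α e ≡ 0ℤ
Fser-last-part-vanishes [] e _ _ last = Fser-[]-vanishes e λ nz-e≡[] → subst LastPartAtLeast2 nz-e≡[] last
Fser-last-part-vanishes (zero ∷ _) e (() ∷ _)
Fser-last-part-vanishes (1 ∷ []) e _ _ last = Fser-[1]-vanishes e λ nz-e≡[1] → ℕP.<-irrefl refl (subst LastPartAtLeast2 nz-e≡[1] last)
Fser-last-part-vanishes (suc (suc a) ∷ []) e _ not-last _ = ⊥-elim (not-last (s≤s (s≤s z≤n)))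
Fser-last-part-vanishes (suc a ∷ b ∷ r) e (_ ∷ br⁺) not-last last = Fser-vanishes (suc a ∷ b ∷ r) e λ T cuts S⊆T nz-e≡ →
  diffs-last-part-1 T cuts (⊆ᵇ⇒⊆ (S (suc a ∷ b ∷ r)) T S⊆T (psumsFrom-last-cut 0 (suc a) b r br⁺ not-last)) (subst LastPartAtLeast2 nz-e≡ last)

F-support-first : ∀ L E → ValidExp L → FirstPartAtLeast2 (nz E) → ser L E ≢ 0ℤ →
  ∃ λ γ → IsComposition γ × FirstPartAtLeast2 γ × coeffF L γ ≢ 0ℤ
F-support-first L E valid first =
  F-support FirstPartAtLeast2 FirstPartAtLeast2? L E valid (λ α α⁺ not-first → Fser-first-part-vanishes α E α⁺ not-first first)

F-support-last : ∀ L E → ValidExp L → LastPartAtLeast2 (nz E) → ser L E ≢ 0ℤ →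
  ∃ λ γ → IsComposition γ × LastPartAtLeast2 γ × coeffF L γ ≢ 0ℤ
F-support-last L E valid last =
  F-support LastPartAtLeast2 LastPartAtLeast2? L E valid (λ α α⁺ not-last → Fser-last-part-vanishes α E α⁺ not-last last)

module _ (L₁ L₂ : FExp) where

  private
    D₁ D₂ : ℕ
    D₁ = degreeBound L₁
    D₂ = degreeBound L₂
    f₁-degree : DegreeAtMost (D₁ + D₂) (ser L₁)
    f₁-degree = DegreeAtMost-mono (ser L₁) (ℕP.m≤m+n D₁ D₂) (ser-degree L₁)
    f₂-degree : DegreeAtMost (D₁ + D₂) (ser L₂)
    f₂-degree = DegreeAtMost-mono (ser L₂) (ℕP.m≤n+m D₂ D₁) (ser-degree L₂)

  product-F-expansion : ∃ λ L → ValidExp L × (∀ e → ser L e ≡ (ser L₁ *ˢ ser L₂) e)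
  product-F-expansion =
    F-expansion (ser L₁ *ˢ ser L₂) (D₁ + D₂)
      (*ˢ-quasisymmetric (ser L₁) (ser L₂) (ser-quasisymmetric L₁) (ser-quasisymmetric L₂))
      (*ˢ-degree (ser L₁) (ser L₂) D₁ D₂ (ser-degree L₁) (ser-degree L₂))

  product-first-part-witness : ¬ IsConstant (ser L₁) → ¬ IsConstant (ser L₂) →
    ∃ λ E → FirstPartAtLeast2 (nz E) × (ser L₁ *ˢ ser L₂) E ≢ 0ℤ
  product-first-part-witness =
    first-part-witness (ser L₁) (ser L₂) (D₁ + D₂) (ser-quasisymmetric L₁) (ser-quasisymmetric L₂) f₁-degree f₂-degree

  product-last-part-witness : ¬ IsConstant (ser L₁) → ¬ IsConstant (ser L₂) →
    ∃ λ E → LastPartAtLeast2 (nz E) × (ser L₁ *ˢ ser L₂) E ≢ 0ℤ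
  product-last-part-witness =
    last-part-witness (ser L₁) (ser L₂) (D₁ + D₂) (ser-quasisymmetric L₁) (ser-quasisymmetric L₂) f₁-degree f₂-degree

lemma4p5 : (L₁ L₂ : FExp) → ValidExp L₁ → ValidExp L₂
    → ¬ IsConstant (ser L₁) → ¬ IsConstant (ser L₂)
    → (∃ λ L → ValidExp L × (∀ e → ser L e ≡ (ser L₁ *ˢ ser L₂) e)
         × ∃ λ γ → IsComposition γ × FirstPartAtLeast2 γ × coeffF L γ ≢ 0ℤ)
    × (∃ λ L → ValidExp L × (∀ e → ser L e ≡ (ser L₁ *ˢ ser L₂) e)
         × ∃ λ γ → IsComposition γ × LastPartAtLeast2 γ × coeffF L γ ≢ 0ℤ)
lemma4p5 L₁ L₂ _ _ f₁-nc f₂-nc =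
  let L , L-valid , ser-L = product-F-expansion L₁ L₂
      E₁ , first , h[E₁]≢0 = product-first-part-witness L₁ L₂ f₁-nc f₂-nc
      E₂ , last , h[E₂]≢0 = product-last-part-witness L₁ L₂ f₁-nc f₂-nc
  in (L , L-valid , ser-L , F-support-first L E₁ L-valid first (λ L[E₁]≡0 → h[E₁]≢0 (trans (sym (ser-L E₁)) L[E₁]≡0))) ,
     (L , L-valid , ser-L , F-support-last L E₂ L-valid last (λ L[E₂]≡0 → h[E₂]≢0 (trans (sym (ser-L E₂)) L[E₂]≡0)))
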